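{- Let $M_1,M_2$ be models of PA, let $h$ be an isomorphism of the linear order $(M_1,<_{M_1})$ onto $(M_2,<_{M_2})$, and suppose $M_1$ is 4-o.r. Then for all $a,b\in M_1\setminus\mathbb N$: if $h(a)\,E^4_{M_2}\,h(b)$ then $a\,E^4_{M_1}\,b$.
   Context: Models of PA are in the vocabulary $\{0,1,<,+,\times\}$ and ordinary, i.e. $\mathbb N$ is an initial segment. $M_{<a}=\{c\in M:c<_M a\}$. On $M\setminus\mathbb N$: $a\,E^4_M\,b$ iff there is $n\in\mathbb N$ with $a<_M b^n$ and $b<_M a^n$. $M$ is 4-o.r. if for all $a,b\in M\setminus\mathbb N$, $(M_{<a},<_M)\cong(M_{<b},<_M)$ implies $a\,E^4_M\,b$. -}

module Defs where

open import Data.Nat using (ℕ; zero; suc)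
open import Data.Fin using (Fin)
open import Data.Empty using (⊥)
open import Data.Product using (Σ; _×_; _,_; proj₁; ∃)
open import Data.Sum using (_⊎_)
open import Relation.Nullary using (¬_; Dec)
open import Relation.Binary.PropositionalEquality using (_≡_; _≢_)

-- Classical metatheory: the excluded middle, taken as an explicit
-- hypothesis of the theorem (the paper works classically).

LEM : Set₁
LEM = (P : Set) → Dec P

-- First-order syntax in the vocabulary {0,1,<,+,×}
-- (de Bruijn variables: Fin n = the n free variables).

data Term (n : ℕ) : Set where
  var  : Fin n → Term n
  `0 `1 : Term n
  _`+_ _`×_ : Term n → Term n → Term n

data Formula (n : ℕ) : Set where
  `⊥        : Formula n
  _`≈_ _`<_ : Term n → Term n → Formula n
  _`⇒_ _`∧_ _`∨_ : Formula n → Formula n → Formula n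
  `∀ `∃     : Formula (suc n) → Formula n

record Structure : Set₁ where
  field
    Carrier : Set
    O I     : Carrier
    _⊕_ _⊗_ : Carrier → Carrier → Carrier
    _≺_     : Carrier → Carrier → Set

module Sem (S : Structure) where
  open Structure S

  Env : ℕ → Set
  Env n = Fin n → Carrier

  extend : ∀ {n} → Carrier → Env n → Env (suc n)
  extend x ρ Fin.zero    = x
  extend x ρ (Fin.suc i) = ρ i

  ⟦_⟧t : ∀ {n} → Term n → Env n → Carrier
  ⟦ var i ⟧t ρ   = ρ i
  ⟦ `0 ⟧t ρ      = O
  ⟦ `1 ⟧t ρ      = I
  ⟦ s `+ t ⟧t ρ  = ⟦ s ⟧t ρ ⊕ ⟦ t ⟧t ρ
  ⟦ s `× t ⟧t ρ  = ⟦ s ⟧t ρ ⊗ ⟦ t ⟧t ρ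

  ⟦_⟧ : ∀ {n} → Formula n → Env n → Set
  ⟦ `⊥ ⟧ ρ       = ⊥
  ⟦ s `≈ t ⟧ ρ   = ⟦ s ⟧t ρ ≡ ⟦ t ⟧t ρ
  ⟦ s `< t ⟧ ρ   = ⟦ s ⟧t ρ ≺ ⟦ t ⟧t ρ
  ⟦ φ `⇒ ψ ⟧ ρ   = ⟦ φ ⟧ ρ → ⟦ ψ ⟧ ρ
  ⟦ φ `∧ ψ ⟧ ρ   = ⟦ φ ⟧ ρ × ⟦ ψ ⟧ ρ
  ⟦ φ `∨ ψ ⟧ ρ   = ⟦ φ ⟧ ρ ⊎ ⟦ ψ ⟧ ρ
  ⟦ `∀ φ ⟧ ρ     = (x : Carrier) → ⟦ φ ⟧ (extend x ρ)
  ⟦ `∃ φ ⟧ ρ     = Σ Carrier λ x → ⟦ φ ⟧ (extend x ρ)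

-- Models of PA: the axioms of PA⁻ (discretely ordered commutative
-- semiring, Kaye's axiomatization; written out semantically) together
-- with the induction schema for every formula φ(x, ȳ) with parameters.

record IsPA (S : Structure) : Set where
  open Structure S
  open Sem S
  field
    +-assoc   : ∀ x y z → (x ⊕ y) ⊕ z ≡ x ⊕ (y ⊕ z)
    +-comm    : ∀ x y → x ⊕ y ≡ y ⊕ x
    ×-assoc   : ∀ x y z → (x ⊗ y) ⊗ z ≡ x ⊗ (y ⊗ z)
    ×-comm    : ∀ x y → x ⊗ y ≡ y ⊗ x
    distrib   : ∀ x y z → x ⊗ (y ⊕ z) ≡ (x ⊗ y) ⊕ (x ⊗ z)
    +-identity : ∀ x → x ⊕ O ≡ x
    ×-zero    : ∀ x → x ⊗ O ≡ O
    ×-identity : ∀ x → x ⊗ I ≡ x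
    irrefl    : ∀ x → ¬ (x ≺ x)
    trans     : ∀ x y z → x ≺ y → y ≺ z → x ≺ z
    trichotomy : ∀ x y → x ≺ y ⊎ (x ≡ y ⊎ y ≺ x)
    +-mono    : ∀ x y z → x ≺ y → (x ⊕ z) ≺ (y ⊕ z)
    ×-mono    : ∀ x y z → O ≺ z → x ≺ y → (x ⊗ z) ≺ (y ⊗ z)
    sub       : ∀ x y → x ≺ y → Σ Carrier λ z → x ⊕ z ≡ y
    zero<one  : O ≺ I
    discrete  : ∀ x → O ≺ x → (I ≡ x ⊎ I ≺ x)
    nonneg    : ∀ x → (O ≡ x ⊎ O ≺ x)
    induction : ∀ {n} (φ : Formula (suc n)) (ρ : Env n) →
                ⟦ φ ⟧ (extend O ρ) →
                (∀ x → ⟦ φ ⟧ (extend x ρ) → ⟦ φ ⟧ (extend (x ⊕ I) ρ)) →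
                ∀ x → ⟦ φ ⟧ (extend x ρ)

record PAModel : Set₁ where
  field
    struct : Structure
    isPA   : IsPA struct
  open Structure struct public

module _ (M : PAModel) where
  open PAModel M

  numeral : ℕ → Carrier
  numeral zero    = O
  numeral (suc n) = numeral n ⊕ I

  Nonstandard : Carrier → Set
  Nonstandard a = ∀ (n : ℕ) → a ≢ numeral n

  pow : Carrier → ℕ → Carrier
  pow a zero    = I
  pow a (suc n) = pow a n ⊗ a

  E4 : Carrier → Carrier → Set
  E4 a b = Σ ℕ λ n → (a ≺ pow b n) × (b ≺ pow a n)

  Seg : Carrier → Set
  Seg a = Σ Carrier λ c → c ≺ a

  _<ₛ_ : ∀ {a b} → Seg a → Seg b → Set
  x <ₛ y = proj₁ x ≺ proj₁ y

  SegIso : Carrier → Carrier → Set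
  SegIso a b =
    Σ (Seg a → Seg b) λ f → Σ (Seg b → Seg a) λ g →
      (∀ x → proj₁ (g (f x)) ≡ proj₁ x) ×
      (∀ y → proj₁ (f (g y)) ≡ proj₁ y) ×
      (∀ x y → (x <ₛ y → f x <ₛ f y) × (f x <ₛ f y → x <ₛ y))

  FourOR : Set
  FourOR = ∀ a b → Nonstandard a → Nonstandard b → SegIso a b → E4 a b

record OrderIso (M₁ M₂ : PAModel) : Set where
  private
    module M₁ = PAModel M₁
    module M₂ = PAModel M₂
  field
    to      : M₁.Carrier → M₂.Carrier
    from    : M₂.Carrier → M₁.Carrier
    from-to : ∀ x → from (to x) ≡ x
    to-from : ∀ y → to (from y) ≡ y
    mono    : ∀ x y → M₁._≺_ x y → M₂._≺_ (to x) (to y)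
    reflect : ∀ x y → M₂._≺_ (to x) (to y) → M₁._≺_ x y

-- Division with remainder (an instance of induction) identifies M_{<x*y} with the lexicographic
-- product M_{<y} × M_{<x}, so the order type of M_{<a^k} depends only on that of M_{<a}. Let
-- a ≤ b with h(b) < h(a)^n and k = n + 1. Then h and h⁻¹ give M₁_{<a^k} ≅ M₂_{<h(a)^k} ≅ M₁_{<e}
-- for e = h⁻¹(h(a)^k) > b, and 4-o.r. yields e < (a^k)^m for some m; so b < a^(mk), and a E⁴ b.
module Submission where

open import Defs
open import Level using (Level; _⊔_; 0ℓ)
open import Data.Empty using (⊥-elim)
open import Data.Product using (Σ; _×_; _,_; proj₁; proj₂)
open import Data.Nat as ℕ using (ℕ; zero; suc)
open import Data.Fin using (#_)
open import Data.Product.Relation.Binary.Lex.Strict using (×-strictTotalOrder)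
open import Data.Sum using (inj₁; inj₂)
open import Relation.Binary.Bundles using (StrictTotalOrder)
open import Relation.Binary.Definitions using (Trichotomous; tri<; tri≈; tri>)
import Relation.Binary.Construct.On as On
open import Relation.Binary.PropositionalEquality as ≡ using (_≡_; refl)

record _≅_ {a ℓ₁ ℓ₂ b ℓ₃ ℓ₄} (P : StrictTotalOrder a ℓ₁ ℓ₂) (Q : StrictTotalOrder b ℓ₃ ℓ₄)
         : Set (a ⊔ ℓ₁ ⊔ ℓ₂ ⊔ b ⊔ ℓ₃ ⊔ ℓ₄) where
  private
    module P = StrictTotalOrder P
    module Q = StrictTotalOrder Q
  field
    to      : P.Carrier → Q.Carrier
    from    : Q.Carrier → P.Carrier
    to-cong : ∀ {x y} → x P.≈ y → to x Q.≈ to y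
    to-from : ∀ y → to (from y) Q.≈ y
    to-mono : ∀ {x y} → x P.< y → to x Q.< to y

  to-cancel : ∀ {x y} → to x Q.< to y → x P.< y
  to-cancel {x} {y} p with P.compare x y
  ... | tri< x<y _ _ = x<y
  ... | tri≈ _ x≈y _ = ⊥-elim (Q.irrefl (to-cong x≈y) p)
  ... | tri> _ _ y<x = ⊥-elim (Q.asym p (to-mono y<x))

  to-injective : ∀ {x y} → to x Q.≈ to y → x P.≈ y
  to-injective {x} {y} e with P.compare x y
  ... | tri< x<y _ _ = ⊥-elim (Q.irrefl e (to-mono x<y))
  ... | tri≈ _ x≈y _ = x≈y
  ... | tri> _ _ y<x = ⊥-elim (Q.irrefl (Q.Eq.sym e) (to-mono y<x))

  from-to : ∀ x → from (to x) P.≈ x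
  from-to x = to-injective (to-from (to x))

  from-cong : ∀ {x y} → x Q.≈ y → from x P.≈ from y
  from-cong e = to-injective (Q.Eq.trans (to-from _) (Q.Eq.trans e (Q.Eq.sym (to-from _))))

  from-mono : ∀ {x y} → x Q.< y → from x P.< from y
  from-mono p = to-cancel (Q.<-respˡ-≈ (Q.Eq.sym (to-from _)) (Q.<-respʳ-≈ (Q.Eq.sym (to-from _)) p))

private
  variable
    a b c d ℓ₁ ℓ₂ ℓ₃ ℓ₄ ℓ₅ ℓ₆ ℓ₇ ℓ₈ : Level
    P : StrictTotalOrder a ℓ₁ ℓ₂
    Q : StrictTotalOrder b ℓ₃ ℓ₄
    R : StrictTotalOrder c ℓ₅ ℓ₆
    S : StrictTotalOrder d ℓ₇ ℓ₈

≅-sym : P ≅ Q → Q ≅ P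
≅-sym i = record
  { to = from ; from = to ; to-cong = from-cong ; to-from = from-to ; to-mono = from-mono }
  where open _≅_ i

≅-trans : P ≅ Q → Q ≅ R → P ≅ R
≅-trans {R = R} i j = record
  { to      = λ x → J.to (I.to x)
  ; from    = λ z → I.from (J.from z)
  ; to-cong = λ e → J.to-cong (I.to-cong e)
  ; to-from = λ z → R.Eq.trans (J.to-cong (I.to-from _)) (J.to-from z)
  ; to-mono = λ p → J.to-mono (I.to-mono p)
  }
  where
  module I = _≅_ i
  module J = _≅_ j
  module R = StrictTotalOrder R

×-≅ : P ≅ R → Q ≅ S → ×-strictTotalOrder P Q ≅ ×-strictTotalOrder R S
×-≅ i j = record
  { to      = λ (x , y) → I.to x , J.to y
  ; from    = λ (x , y) → I.from x , J.from y
  ; to-cong = λ (e₁ , e₂) → I.to-cong e₁ , J.to-cong e₂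
  ; to-from = λ (x , y) → I.to-from x , J.to-from y
  ; to-mono = λ { (inj₁ p) → inj₁ (I.to-mono p) ; (inj₂ (e , q)) → inj₂ (I.to-cong e , J.to-mono q) }
  }
  where
  module I = _≅_ i
  module J = _≅_ j

module _ (M : PAModel) where
  open PAModel M renaming (_≺_ to infix 4 _<_)
  open IsPA isPA using (irrefl; trichotomy) renaming (trans to <-trans′)

  <-strictTotalOrder : StrictTotalOrder 0ℓ 0ℓ 0ℓ
  <-strictTotalOrder = record
    { Carrier            = Carrier
    ; _≈_                = _≡_
    ; _<_                = _<_
    ; isStrictTotalOrder = record
      { isStrictPartialOrder = record
        { isEquivalence = ≡.isEquivalence
        ; irrefl        = λ { refl → irrefl _ }
        ; trans         = <-trans′ _ _ _
        ; <-resp-≈      = (λ { refl p → p }) , (λ { refl p → p })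
        }
      ; compare = compare
      }
    }
    where
    compare : Trichotomous _≡_ _<_
    compare x y with trichotomy x y
    ... | inj₁ x<y         = tri< x<y (λ { refl → irrefl x x<y }) (λ y<x → irrefl x (<-trans′ _ _ _ x<y y<x))
    ... | inj₂ (inj₁ refl) = tri≈ (irrefl x) refl (irrefl x)
    ... | inj₂ (inj₂ y<x)  = tri> (λ x<y → irrefl x (<-trans′ _ _ _ x<y y<x)) (λ { refl → irrefl x y<x }) y<x

  segment : Carrier → StrictTotalOrder 0ℓ 0ℓ 0ℓ
  segment a = On.strictTotalOrder <-strictTotalOrder (proj₁ {B = λ c → c < a})

module Arithmetic (M : PAModel) where
  open PAModel M renaming (_⊕_ to infixl 6 _+_; _⊗_ to infixl 7 _*_; _≺_ to infix 4 _<_)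
  open IsPA isPA hiding (trans)
  open import Relation.Binary.Construct.StrictToNonStrict _≡_ _<_ using (_≤_) public
  open import Relation.Binary.Reasoning.StrictPartialOrder
    (StrictTotalOrder.strictPartialOrder (<-strictTotalOrder M))

  <-trans : ∀ {x y z} → x < y → y < z → x < z
  <-trans = IsPA.trans isPA _ _ _

  <-≤-trans : ∀ {x y z} → x < y → y ≤ z → x < z
  <-≤-trans p (inj₁ q)    = <-trans p q
  <-≤-trans p (inj₂ refl) = p

  ≤-<-trans : ∀ {x y z} → x ≤ y → y < z → x < z
  ≤-<-trans (inj₁ p)    q = <-trans p q
  ≤-<-trans (inj₂ refl) q = q

  ≤-trans : ∀ {x y z} → x ≤ y → y ≤ z → x ≤ z
  ≤-trans (inj₁ p)    q = inj₁ (<-≤-trans p q)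
  ≤-trans (inj₂ refl) q = q

  O≤ : ∀ x → O ≤ x
  O≤ x with nonneg x
  ... | inj₁ O≡x = inj₂ O≡x
  ... | inj₂ O<x = inj₁ O<x

  +-monoʳ-< : ∀ z {x y} → x < y → z + x < z + y
  +-monoʳ-< z {x} {y} p = ≡.subst₂ _<_ (+-comm x z) (+-comm y z) (+-mono x y z p)

  x≤x+y : ∀ x y → x ≤ x + y
  x≤x+y x y with nonneg y
  ... | inj₁ refl = inj₂ (≡.sym (+-identity x))
  ... | inj₂ O<y  = inj₁ (≡.subst (_< x + y) (+-identity x) (+-monoʳ-< x O<y))

  x<x+I : ∀ x → x < x + I
  x<x+I x = ≡.subst (_< x + I) (+-identity x) (+-monoʳ-< x zero<one)

  O+I≡I : O + I ≡ I
  O+I≡I = ≡.trans (+-comm O I) (+-identity I)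

  <⇒+I≤ : ∀ {x y} → x < y → x + I ≤ y
  <⇒+I≤ {x} {y} x<y with sub x y x<y
  ... | d , x+d≡y with nonneg d
  ...   | inj₁ refl = ⊥-elim (irrefl x (≡.subst (x <_) (≡.trans (≡.sym x+d≡y) (+-identity x)) x<y))
  ...   | inj₂ O<d with discrete d O<d
  ...     | inj₁ refl = inj₂ x+d≡y
  ...     | inj₂ I<d  = inj₁ (≡.subst (x + I <_) x+d≡y (+-monoʳ-< x I<d))

  <+I⇒≤ : ∀ {x y} → x < y + I → x ≤ y
  <+I⇒≤ {x} {y} p with trichotomy x y
  ... | inj₁ x<y         = inj₁ x<y
  ... | inj₂ (inj₁ x≡y)  = inj₂ x≡y
  ... | inj₂ (inj₂ y<x)  = ⊥-elim (irrefl x (<-≤-trans p (<⇒+I≤ y<x)))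

  <I⇒≡O : ∀ {x} → x < I → x ≡ O
  <I⇒≡O {x} x<I with <+I⇒≤ (≡.subst (x <_) (≡.sym O+I≡I) x<I)
  ... | inj₁ x<O = ⊥-elim (irrefl x (<-≤-trans x<O (O≤ x)))
  ... | inj₂ x≡O = x≡O

  ≤numeral⇒numeral : ∀ m {x} → x ≤ numeral M m → Σ ℕ λ j → x ≡ numeral M j
  ≤numeral⇒numeral zero    (inj₁ x<O) = ⊥-elim (irrefl _ (<-≤-trans x<O (O≤ _)))
  ≤numeral⇒numeral m       (inj₂ x≡m) = m , x≡m
  ≤numeral⇒numeral (suc m) (inj₁ x<m+I) = ≤numeral⇒numeral m (<+I⇒≤ x<m+I)

  Nonstandard-mono : ∀ {x y} → x ≤ y → Nonstandard M x → Nonstandard M y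
  Nonstandard-mono {x} x≤y nsx n refl with ≤numeral⇒numeral n x≤y
  ... | j , x≡j = nsx j x≡j

  Nonstandard⇒O< : ∀ {a} → Nonstandard M a → O < a
  Nonstandard⇒O< {a} nsa with nonneg a
  ... | inj₁ O≡a = ⊥-elim (nsa 0 (≡.sym O≡a))
  ... | inj₂ O<a = O<a

  Nonstandard⇒I< : ∀ {a} → Nonstandard M a → I < a
  Nonstandard⇒I< {a} nsa with discrete a (Nonstandard⇒O< nsa)
  ... | inj₁ I≡a = ⊥-elim (nsa 1 (≡.trans (≡.sym I≡a) (≡.sym O+I≡I)))
  ... | inj₂ I<a = I<a

  I*x≡x : ∀ x → I * x ≡ x
  I*x≡x x = ≡.trans (×-comm I x) (×-identity x)

  O*x≡O : ∀ x → O * x ≡ O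
  O*x≡O x = ≡.trans (×-comm O x) (×-zero x)

  [x+I]*y≡x*y+y : ∀ x y → (x + I) * y ≡ x * y + y
  [x+I]*y≡x*y+y x y = begin-equality
    (x + I) * y     ≡⟨ ×-comm (x + I) y ⟩
    y * (x + I)     ≡⟨ distrib y x I ⟩
    y * x + y * I   ≡⟨ ≡.cong₂ _+_ (×-comm y x) (×-identity y) ⟩
    x * y + y       ∎

  *-monoˡ-≤ : ∀ {x y} z → O < z → x ≤ y → x * z ≤ y * z
  *-monoˡ-≤ z O<z (inj₁ x<y)  = inj₁ (×-mono _ _ z O<z x<y)
  *-monoˡ-≤ z O<z (inj₂ refl) = inj₂ refl

  x≤x*y : ∀ x {y} → O < y → x ≤ x * y
  x≤x*y x {y} O<y with nonneg x
  ... | inj₁ refl = inj₂ (≡.sym (O*x≡O y))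
  ... | inj₂ O<x  = begin
    x      ≡⟨ ≡.sym (I*x≡x x) ⟩
    I * x  ≤⟨ *-monoˡ-≤ x O<x (≡.subst (_≤ y) O+I≡I (<⇒+I≤ O<y)) ⟩
    y * x  ≡⟨ ×-comm y x ⟩
    x * y  ∎

  x<x*y : ∀ {x y} → O < x → I < y → x < x * y
  x<x*y {x} {y} O<x I<y = ≡.subst₂ _<_ (I*x≡x x) (×-comm y x) (×-mono I y x O<x I<y)

  O<x*y⇒O<x : ∀ {x y} → O < x * y → O < x
  O<x*y⇒O<x {x} {y} O<x*y with nonneg x
  ... | inj₁ refl = ⊥-elim (irrefl O (≡.subst (O <_) (O*x≡O y) O<x*y))
  ... | inj₂ O<x  = O<x

  q*x+r<q′*x+r′ : ∀ {x q q′ r r′} → q < q′ → r < x → q * x + r < q′ * x + r′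
  q*x+r<q′*x+r′ {x} {q} {q′} {r} {r′} q<q′ r<x = begin-strict
    q * x + r      <⟨ +-monoʳ-< (q * x) r<x ⟩
    q * x + x      ≡⟨ ≡.sym ([x+I]*y≡x*y+y q x) ⟩
    (q + I) * x    ≤⟨ *-monoˡ-≤ x (≤-<-trans (O≤ r) r<x) (<⇒+I≤ q<q′) ⟩
    q′ * x         ≤⟨ x≤x+y (q′ * x) r′ ⟩
    q′ * x + r′    ∎

  q*x+r<x*y : ∀ {x y q r} → q < y → r < x → q * x + r < x * y
  q*x+r<x*y {x} {y} {q} {r} q<y r<x = begin-strict
    q * x + r   <⟨ q*x+r<q′*x+r′ q<y r<x ⟩
    y * x + O   ≡⟨ +-identity (y * x) ⟩
    y * x       ≡⟨ ×-comm y x ⟩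
    x * y       ∎

  Division : Carrier → Carrier → Carrier → Set
  Division x y z = Σ Carrier λ q → Σ Carrier λ r → ((q < y) × (r < x)) × (q * x + r ≡ z)

  -- z, x, y are the variables 0, 1, 2; its meaning is definitionally z < x * y → Division x y z.
  divisionFormula : Formula 3
  divisionFormula = (var (# 0) `< (var (# 1) `× var (# 2))) `⇒
    `∃ (`∃ (((var (# 1) `< var (# 4)) `∧ (var (# 0) `< var (# 3))) `∧
            (((var (# 1) `× var (# 3)) `+ var (# 0)) `≈ var (# 2))))

  division : ∀ x y z → z < x * y → Division x y z
  division x y = induction divisionFormula (Sem.extend struct x (Sem.extend struct y λ ())) base step
    where
    base : O < x * y → Division x y O
    base O<x*y = O , O , (O<x*y⇒O<x (≡.subst (O <_) (×-comm x y) O<x*y) , O<x*y⇒O<x O<x*y)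
                     , ≡.trans (+-identity (O * x)) (O*x≡O x)

    step : ∀ z → (z < x * y → Division x y z) → z + I < x * y → Division x y (z + I)
    step z ih z+I<x*y with ih (<-trans (x<x+I z) z+I<x*y)
    ... | q , r , (q<y , r<x) , q*x+r≡z with <⇒+I≤ r<x
    ...   | inj₁ r+I<x = q , r + I , (q<y , r+I<x) , ≡.trans (≡.sym (+-assoc (q * x) r I)) (≡.cong (_+ I) q*x+r≡z)
    ...   | inj₂ r+I≡x = q + I , O , (q+I<y , ≤-<-trans (O≤ r) r<x) , ≡.trans (+-identity _) [q+I]*x≡z+I
      where
      [q+I]*x≡z+I : (q + I) * x ≡ z + I
      [q+I]*x≡z+I = begin-equality
        (q + I) * x        ≡⟨ [x+I]*y≡x*y+y q x ⟩
        q * x + x          ≡⟨ ≡.cong (q * x +_) (≡.sym r+I≡x) ⟩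
        q * x + (r + I)    ≡⟨ ≡.sym (+-assoc (q * x) r I) ⟩
        q * x + r + I      ≡⟨ ≡.cong (_+ I) q*x+r≡z ⟩
        z + I              ∎
      q+I<y : q + I < y
      q+I<y with <⇒+I≤ q<y
      ... | inj₁ q+I<y = q+I<y
      ... | inj₂ refl  = ⊥-elim (irrefl (z + I) (≡.subst (z + I <_) (≡.trans (×-comm x (q + I)) [q+I]*x≡z+I) z+I<x*y))

  segment-* : ∀ x y → ×-strictTotalOrder (segment M y) (segment M x) ≅ segment M (x * y)
  segment-* x y = record
    { to      = λ ((q , q<y) , (r , r<x)) → q * x + r , q*x+r<x*y q<y r<x
    ; from    = λ (z , z<x*y) → let (q , r , (q<y , r<x) , _) = division x y z z<x*y in (q , q<y) , (r , r<x)
    ; to-cong = λ (q≡q′ , r≡r′) → ≡.cong₂ (λ q r → q * x + r) q≡q′ r≡r′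
    ; to-from = λ (z , z<x*y) → proj₂ (proj₂ (proj₂ (division x y z z<x*y)))
    ; to-mono = λ { {_ , (_ , r<x)} (inj₁ q<q′) → q*x+r<q′*x+r′ q<q′ r<x
                  ; {(q , _) , _} (inj₂ (refl , r<r′)) → +-monoʳ-< (q * x) r<r′ }
    }

  pow-pos : ∀ {a} → O < a → ∀ n → O < pow M a n
  pow-pos O<a zero    = zero<one
  pow-pos O<a (suc n) = <-≤-trans (pow-pos O<a n) (x≤x*y _ O<a)

  a≤pow-suc : ∀ {a} → O < a → ∀ n → a ≤ pow M a (suc n)
  a≤pow-suc {a} O<a zero    = inj₂ (≡.sym (I*x≡x a))
  a≤pow-suc {a} O<a (suc n) = ≤-trans (a≤pow-suc O<a n) (x≤x*y _ O<a)

  pow-+ : ∀ a i j → pow M a (i ℕ.+ j) ≡ pow M a i * pow M a j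
  pow-+ a zero    j = ≡.sym (I*x≡x _)
  pow-+ a (suc i) j = begin-equality
    pow M a (i ℕ.+ j) * a               ≡⟨ ≡.cong (_* a) (pow-+ a i j) ⟩
    pow M a i * pow M a j * a           ≡⟨ ×-assoc _ _ _ ⟩
    pow M a i * (pow M a j * a)         ≡⟨ ≡.cong (pow M a i *_) (×-comm _ a) ⟩
    pow M a i * (a * pow M a j)         ≡⟨ ≡.sym (×-assoc _ _ _) ⟩
    pow M a i * a * pow M a j           ∎

  pow-* : ∀ a k m → pow M (pow M a k) m ≡ pow M a (m ℕ.* k)
  pow-* a k zero    = refl
  pow-* a k (suc m) = begin-equality
    pow M (pow M a k) m * pow M a k     ≡⟨ ≡.cong (_* pow M a k) (pow-* a k m) ⟩
    pow M a (m ℕ.* k) * pow M a k       ≡⟨ ×-comm _ _ ⟩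
    pow M a k * pow M a (m ℕ.* k)       ≡⟨ ≡.sym (pow-+ a k (m ℕ.* k)) ⟩
    pow M a (k ℕ.+ m ℕ.* k)             ∎

  ≤∧<pow⇒E4 : ∀ {a b} j → O < a → I < b → a ≤ b → b < pow M a j → E4 M a b
  ≤∧<pow⇒E4 {a} {b} j O<a I<b a≤b b<aʲ = suc (suc j) , a<bᴺ , b<aᴺ
    where
    a<bᴺ : a < pow M b (suc (suc j))
    a<bᴺ = begin-strict
      a                      ≤⟨ a≤b ⟩
      b                      ≤⟨ a≤pow-suc (<-trans zero<one I<b) j ⟩
      pow M b (suc j)        <⟨ x<x*y (pow-pos (<-trans zero<one I<b) (suc j)) I<b ⟩
      pow M b (suc (suc j))  ∎
    b<aᴺ : b < pow M a (suc (suc j))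
    b<aᴺ = begin-strict
      b                      <⟨ b<aʲ ⟩
      pow M a j              ≤⟨ x≤x*y _ O<a ⟩
      pow M a (suc j)        ≤⟨ x≤x*y _ O<a ⟩
      pow M a (suc (suc j))  ∎

E4-sym : ∀ {M a b} → E4 M a b → E4 M b a
E4-sym (n , a<bⁿ , b<aⁿ) = n , b<aⁿ , a<bⁿ

≅⇒SegIso : ∀ {M a b} → segment M a ≅ segment M b → SegIso M a b
≅⇒SegIso i = to , from , from-to , to-from , λ x y → to-mono , to-cancel
  where open _≅_ i

module _ (M N : PAModel) where
  private
    module M = PAModel M
    module N = PAModel N
    module AM = Arithmetic M
    module AN = Arithmetic N

  segment-I-≅ : segment M M.I ≅ segment N N.I
  segment-I-≅ = record
    { to      = λ _ → N.O , IsPA.zero<one N.isPA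
    ; from    = λ _ → M.O , IsPA.zero<one M.isPA
    ; to-cong = λ _ → refl
    ; to-from = λ (y , y<I) → ≡.sym (AN.<I⇒≡O y<I)
    ; to-mono = λ { {x , x<I} {y , y<I} x<y → ⊥-elim (IsPA.irrefl M.isPA M.O
                    (≡.subst₂ M._≺_ (AM.<I⇒≡O x<I) (AM.<I⇒≡O y<I) x<y)) }
    }

  segment-*-≅ : ∀ {x x′ y y′} → segment M x ≅ segment N x′ → segment M y ≅ segment N y′ →
                segment M (x M.⊗ y) ≅ segment N (x′ N.⊗ y′)
  segment-*-≅ {x} {x′} {y} {y′} i j =
    ≅-trans (≅-sym (AM.segment-* x y)) (≅-trans (×-≅ j i) (AN.segment-* x′ y′))

  segment-pow-≅ : ∀ {a b} → segment M a ≅ segment N b → ∀ k → segment M (pow M a k) ≅ segment N (pow N b k)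
  segment-pow-≅ i zero    = segment-I-≅
  segment-pow-≅ i (suc k) = segment-*-≅ (segment-pow-≅ i k) i

  segment-≅ : (h : OrderIso M N) → ∀ a → segment M a ≅ segment N (OrderIso.to h a)
  segment-≅ h a = record
    { to      = λ (x , x<a) → to x , mono x a x<a
    ; from    = λ (y , y<ha) → from y , reflect (from y) a (≡.subst (N._≺ to a) (≡.sym (to-from y)) y<ha)
    ; to-cong = ≡.cong to
    ; to-from = λ (y , _) → to-from y
    ; to-mono = mono _ _
    }
    where open OrderIso h

OrderIso-sym : ∀ {M N} → OrderIso M N → OrderIso N M
OrderIso-sym {M} {N} h = record
  { to      = from
  ; from    = to
  ; from-to = to-from
  ; to-from = from-to
  ; mono    = λ x y x<y → reflect (from x) (from y) (≡.subst₂ (PAModel._≺_ N) (≡.sym (to-from x)) (≡.sym (to-from y)) x<y)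
  ; reflect = λ x y p → ≡.subst₂ (PAModel._≺_ N) (to-from x) (to-from y) (mono (from x) (from y) p)
  }
  where open OrderIso h

module _ {M₁ M₂ : PAModel} (h : OrderIso M₁ M₂) (fourOR : FourOR M₁) where
  private
    module M₁ = PAModel M₁
    module M₂ = PAModel M₂
    module A₁ = Arithmetic M₁
    module A₂ = Arithmetic M₂
    open OrderIso h

  E4-of-≤ : ∀ {a b} → Nonstandard M₁ a → Nonstandard M₁ b → a A₁.≤ b →
            ∀ n → to b M₂.≺ pow M₂ (to a) n → E4 M₁ a b
  E4-of-≤ {a} {b} nsa nsb a≤b n hb<haⁿ =
    A₁.≤∧<pow⇒E4 (m ℕ.* k) O<a (A₁.Nonstandard⇒I< nsb) a≤b b<aᵐᵏ
    where
    O<a : M₁.O M₁.≺ a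
    O<a = A₁.Nonstandard⇒O< nsa
    k : ℕ
    k = suc n
    e : M₁.Carrier
    e = from (pow M₂ (to a) k)
    b<e : b M₁.≺ e
    b<e = reflect b e (≡.subst (to b M₂.≺_) (≡.sym (to-from _))
                        (A₂.<-≤-trans hb<haⁿ (A₂.x≤x*y _ (A₂.≤-<-trans (A₂.O≤ (to M₁.O)) (mono M₁.O a O<a)))))
    aᵏ≅e : segment M₁ (pow M₁ a k) ≅ segment M₁ e
    aᵏ≅e = ≅-trans (segment-pow-≅ M₁ M₂ (segment-≅ M₁ M₂ h a) k) (segment-≅ M₂ M₁ (OrderIso-sym h) _)
    aᵏE4e : E4 M₁ (pow M₁ a k) e
    aᵏE4e = fourOR _ _ (A₁.Nonstandard-mono (A₁.a≤pow-suc O<a n) nsa) (A₁.Nonstandard-mono (inj₁ b<e) nsb)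
                   (≅⇒SegIso aᵏ≅e)
    m : ℕ
    m = proj₁ aᵏE4e
    b<aᵐᵏ : b M₁.≺ pow M₁ a (m ℕ.* k)
    b<aᵐᵏ = A₁.<-trans b<e (≡.subst (e M₁.≺_) (A₁.pow-* a k m) (proj₂ (proj₂ aᵏE4e)))

claim2p8 : LEM → (M₁ M₂ : PAModel) (h : OrderIso M₁ M₂) → FourOR M₁ →
    ∀ (a b : PAModel.Carrier M₁) → Nonstandard M₁ a → Nonstandard M₁ b →
    E4 M₂ (OrderIso.to h a) (OrderIso.to h b) → E4 M₁ a b
claim2p8 _ M₁ M₂ h fourOR a b nsa nsb (n , ha<hbⁿ , hb<haⁿ)
  with IsPA.trichotomy (PAModel.isPA M₁) a b
... | inj₁ a<b         = E4-of-≤ h fourOR nsa nsb (inj₁ a<b) n hb<haⁿ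
... | inj₂ (inj₁ a≡b)  = E4-of-≤ h fourOR nsa nsb (inj₂ a≡b) n hb<haⁿ
... | inj₂ (inj₂ b<a)  = E4-sym {M₁} (E4-of-≤ h fourOR nsb nsa (inj₁ b<a) n ha<hbⁿ)
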